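{- Let $t$ be a rooted non-plane tree whose leaves carry distinct labels in $\mathbb N$ and whose internal nodes are decorated by $\oplus$, $\ominus$ (at least 2 children) or by a labeled graph $H$ with $|H|\ge 2$ and exactly $|H|$ children, and let $\mathfrak I$ be a partial injection from the set of leaf labels of $t$ to $\mathbb N$. Then $\mathrm{Graph}(t)_{\mathfrak I}=\mathrm{Graph}(t_{\mathfrak I})$.
   Context: Children subtrees of a node are ordered by their minimal leaf label; $\oplus$ and $\ominus$ with $k$ children are read as the complete and edgeless graphs on $\{1,\dots,k\}$. $\mathrm{Graph}(t)$: a single leaf labeled $j$ gives the one-vertex graph labeled $j$; otherwise, with root decoration $H$ and ordered subtrees $t_1,\dots,t_k$, $\mathrm{Graph}(t)=H[\mathrm{Graph}(t_1),\dots,\mathrm{Graph}(t_k)]$, the graph keeping edges inside each $\mathrm{Graph}(t_i)$ and joining a vertex of $\mathrm{Graph}(t_i)$ to one of $\mathrm{Graph}(t_j)$ ($i\ne j$) iff $i,j$ are adjacent in $H$. For a graph $G$ with vertex labels and a partial injection $\mathfrak I$ from its labels to $\mathbb N$, $G_{\mathfrak I}$ is the induced subgraph on the vertices whose label is in the domain of $\mathfrak I$, each label $\ell$ replaced by $\mathfrak I(\ell)$. The induced subtree $t_{\mathfrak I}$: its leaves are the leaves of $t$ whose label $\ell$ is in the domain of $\mathfrak I$ (marked leaves), relabeled $\mathfrak I(\ell)$; its internal nodes are the internal nodes of $t$ that are first common ancestors of at least two marked leaves, with ancestor relation inherited from $t$; a node with decoration $H$ in $t$ receives in $t_{\mathfrak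 I}$ the decoration obtained from $H$ by keeping the vertices $k$ such that the $k$-th subtree contains a marked leaf, relabeling such a vertex $k$ by the minimum of $\mathfrak I$ over the marked leaves of the $k$-th subtree, and then reducing the labels to $\{1,2,\dots\}$ preserving their order. -}

module Defs where

open import Data.Nat using (ℕ; zero; suc; _≤_; _<_; _<?_; _⊓_; _≡ᵇ_)
open import Data.Bool using (Bool; true; false; not; _∧_)
open import Data.Fin using (Fin)
open import Data.Maybe using (Maybe; just; nothing)
open import Data.List using (List; []; _∷_; map; filter; length; concatMap; allFin; lookup; mapMaybe)
open import Data.Bool.ListAction using (any)
open import Data.List.Relation.Unary.Unique.Propositional using (Unique)
open import Data.Product using (Σ; _×_; _,_; proj₁; proj₂)
open import Data.Sum using (_⊎_)
open import Data.Empty using (⊥)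
open import Data.Unit using (⊤)
open import Relation.Binary.PropositionalEquality using (_≡_; _≢_)
open import Function.Bundles using (_⇔_)

record LGraph : Set₁ where
  field
    V : ℕ → Set
    E : ℕ → ℕ → Set
open LGraph public

_≅_ : LGraph → LGraph → Set
G ≅ G' = (∀ u → V G u ⇔ V G' u) × (∀ u v → E G u v ⇔ E G' u v)

emptyG : LGraph
emptyG = record { V = λ _ → ⊥ ; E = λ _ _ → ⊥ }

-- H is a graph on the labels {1,...,k}
-- given by its Boolean adjacency; the k graphs are given as a family
-- Gs indexed by Fin k together with pos : Fin k → ℕ saying which
-- vertex of H (i.e. which position in the ordered list G_1,...,G_k)
-- each of them occupies.
substG : (ℕ → ℕ → Bool) → (k : ℕ) → (Fin k → ℕ) → (Fin k → LGraph) → LGraph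
substG H k pos Gs = record
  { V = λ u → Σ (Fin k) λ i → V (Gs i) u
  ; E = λ u v → (Σ (Fin k) λ i → E (Gs i) u v)
              ⊎ (Σ (Fin k) λ i → Σ (Fin k) λ j →
                   i ≢ j × V (Gs i) u × V (Gs j) v × H (pos i) (pos j) ≡ true)
  }

-- Induced labeled subgraph G_𝔍 for a partial map 𝔍 : ℕ → Maybe ℕ
-- (domain = labels ℓ with 𝔍 ℓ ≡ just _): keep marked vertices, relabel.
induced : LGraph → (ℕ → Maybe ℕ) → LGraph
induced G I = record
  { V = λ w → Σ ℕ λ ℓ → V G ℓ × I ℓ ≡ just w
  ; E = λ w w' → Σ ℕ λ ℓ → Σ ℕ λ ℓ' →
          V G ℓ × V G ℓ' × I ℓ ≡ just w × I ℓ' ≡ just w' × E G ℓ ℓ'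
  }

-- A non-plane tree is represented by a plane tree
-- (children given as a family Fin k → Tree); the order of the family is
-- irrelevant: the "r-th subtree" is always the child whose minimal leaf
-- label has rank r among the children (see rank below).

data Deco : Set where
  ⊕ : Deco
  ⊖ : Deco
  gr : (ℕ → ℕ → Bool) → Deco   -- labeled graph on vertex labels {1,...,k}

data Tree : Set where
  leaf : ℕ → Tree
  node : (k : ℕ) → Deco → (Fin k → Tree) → Tree

leaves : Tree → List ℕ
leaves (leaf ℓ) = ℓ ∷ []
leaves (node k d ts) = concatMap (λ i → leaves (ts i)) (allFin k)

minL : List ℕ → ℕ
minL [] = 0
minL (x ∷ []) = x
minL (x ∷ y ∷ xs) = x ⊓ minL (y ∷ xs)

minLabel : Tree → ℕ
minLabel t = minL (leaves t)

reduce : List ℕ → ℕ → ℕ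
reduce S x = suc (length (filter (_<? x) S))

rank : (k : ℕ) → (Fin k → Tree) → Fin k → ℕ
rank k ts i = reduce (map (λ j → minLabel (ts j)) (allFin k)) (minLabel (ts i))

-- ⊕ / ⊖ with k children are read as complete / edgeless graphs on {1..k}
decoAdj : Deco → ℕ → ℕ → Bool
decoAdj ⊕ a b = not (a ≡ᵇ b)
decoAdj ⊖ a b = false
decoAdj (gr H) a b = H a b

Graph : Tree → LGraph
Graph (leaf ℓ) = record { V = λ u → u ≡ ℓ ; E = λ _ _ → ⊥ }
Graph (node k d ts) = substG (decoAdj d) k (rank k ts) (λ i → Graph (ts i))

GraphM : Maybe Tree → LGraph
GraphM nothing = emptyG
GraphM (just t) = Graph t

SimpleOn : ℕ → (ℕ → ℕ → Bool) → Set
SimpleOn k H = (∀ a b → 1 ≤ a → a ≤ k → 1 ≤ b → b ≤ k → H a b ≡ H b a)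
             × (∀ a → 1 ≤ a → a ≤ k → H a a ≡ false)

DecoOK : ℕ → Deco → Set
DecoOK k ⊕ = ⊤
DecoOK k ⊖ = ⊤
DecoOK k (gr H) = SimpleOn k H

WF : Tree → Set
WF (leaf ℓ) = ⊤
WF (node k d ts) = 2 ≤ k × DecoOK k d × (∀ i → WF (ts i))

PartialInjOn : List ℕ → (ℕ → Maybe ℕ) → Set
PartialInjOn L I = ∀ ℓ ℓ' w → ℓ ∈L L → ℓ' ∈L L → I ℓ ≡ just w → I ℓ' ≡ just w → ℓ ≡ ℓ'
  where
  open import Data.List.Membership.Propositional renaming (_∈_ to _∈L_)

-- Induced subtree t_𝔍 (nothing when t has no marked leaf).

marked : (k : ℕ) → (Fin k → Maybe Tree) → List (Fin k × Tree)
marked k rs = mapMaybe (λ i → Data.Maybe.map (λ s → (i , s)) (rs i)) (allFin k)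
  where import Data.Maybe

-- new decoration: keep the vertices of H whose subtree contains a marked
-- leaf, relabel vertex (old label = rank of the child) by the minimum of
-- 𝔍 over its marked leaves (= minLabel of the induced child), then reduce
-- the labels to {1,2,...} preserving their order.
newDeco : (k : ℕ) → (Fin k → Tree) → (L : List (Fin k × Tree)) → Deco → Deco
newDeco k ts L ⊕ = ⊕
newDeco k ts L ⊖ = ⊖
newDeco k ts L (gr H) = gr H'
  where
  newLabels : List ℕ
  newLabels = map (λ p → minLabel (proj₂ p)) L
  newLab : Fin k × Tree → ℕ
  newLab p = reduce newLabels (minLabel (proj₂ p))
  H' : ℕ → ℕ → Bool
  H' a b = any (λ p → any (λ q → (newLab p ≡ᵇ a) ∧ (newLab q ≡ᵇ b)
                          ∧ H (rank k ts (proj₁ p)) (rank k ts (proj₁ q))) L) L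

build : (k : ℕ) → Deco → (Fin k → Tree) → (Fin k → Maybe Tree) → Maybe Tree
build k d ts rs with marked k rs
... | [] = nothing
... | p ∷ [] = just (proj₂ p)
... | L@(_ ∷ _ ∷ _) = just (node (length L) (newDeco k ts L d) (λ j → proj₂ (lookup L j)))

induceTree : (ℕ → Maybe ℕ) → Tree → Maybe Tree
induceTree I (leaf ℓ) = Data.Maybe.map leaf (I ℓ)
  where import Data.Maybe
induceTree I (node k d ts) = build k d ts (λ i → induceTree I (ts i))

-- Taking an induced subgraph commutes with substitution,
-- (H[G₁,…,Gₖ])_𝔍 = H[(G₁)_𝔍,…,(Gₖ)_𝔍], so by induction it remains to see that at a node,
-- dropping the children without marked leaves and relabelling the vertices of H as in t_𝔍
-- does not change this graph.  Empty children contribute nothing, and a single surviving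
-- child is the whole substitution.  Otherwise the old labels (ranks of the minimal leaf
-- labels of the children) and the new ones (ranks of the minima of 𝔍 over their marked
-- leaves) are both injective on the surviving children, because distinct children have
-- disjoint leaves and 𝔍 is injective; so adjacency in the new decoration is adjacency in H.

module Submission where

open import Defs
open import Data.Nat using (ℕ; suc; _≤_; _<_; _<?_; _<ᵇ_; _≡ᵇ_; s≤s; z≤n)
open import Data.Nat.Properties
  using (≡ᵇ⇒≡; ≡⇒≡ᵇ; <ᵇ-reflects-<; <-cmp; <-trans; <-irrefl; <-≤-trans; <⇒≤; ⊓-sel; m≤n⇒m≤1+n; suc-injective)
open import Data.Bool using (Bool; true; false; _∧_; T)
open import Data.Bool.Properties using (T-≡; T-∧)
open import Data.Bool.ListAction using (any)
open import Data.Fin using (Fin)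
open import Data.Maybe using (Maybe; just; nothing)
import Data.Maybe as Maybe
open import Data.Maybe.Properties using (just-injective)
open import Data.List using (List; []; _∷_; _++_; map; filter; length; concatMap; allFin; lookup; mapMaybe; tabulate)
open import Data.List.Properties using (map-tabulate; tabulate-lookup)
open import Data.List.Membership.Propositional using (_∈_; find; lose)
open import Data.List.Membership.Propositional.Properties
  using (∈-++⁺ʳ; ∈-allFin; ∈-lookup; ∈-map⁺; ∈-concatMap⁺; ∈-concatMap⁻)
open import Data.List.Relation.Unary.Any using (here; there; index)
open import Data.List.Relation.Unary.Any.Properties using (any⁺; any⁻; lookup-index)
import Data.List.Relation.Unary.All as All
import Data.List.Relation.Unary.All.Properties as All
open import Data.List.Relation.Unary.AllPairs using (AllPairs; []; _∷_)
open import Data.List.Relation.Unary.Unique.Propositional using (Unique)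
open import Data.List.Relation.Unary.Unique.Propositional.Properties using (allFin⁺)
open import Data.Product using (Σ; _×_; _,_; proj₁; proj₂)
import Data.Product as Product
open import Data.Sum using (_⊎_; inj₁; inj₂)
open import Data.Empty using (⊥; ⊥-elim)
open import Function using (_∘_)
open import Function.Bundles using (_⇔_; mk⇔; Equivalence)
import Function.Properties.Equivalence as ⇔
open import Relation.Nullary using (¬_; contradiction)
open import Relation.Nullary.Reflects using (ofʸ; ofⁿ)
open import Relation.Binary.Definitions using (tri<; tri≈; tri>)
open import Relation.Binary.PropositionalEquality
  using (_≡_; _≢_; refl; sym; trans; cong; subst; subst₂; module ≡-Reasoning)

open Equivalence using (to; from)

-- Lists

module _ {A : Set} where

  ++-unique⁻ˡ : ∀ {xs ys : List A} → Unique (xs ++ ys) → Unique xs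
  ++-unique⁻ˡ {[]}     _          = []
  ++-unique⁻ˡ {x ∷ xs} (x∉ ∷ xs!) = All.++⁻ˡ xs x∉ ∷ ++-unique⁻ˡ xs!

  ++-unique⁻ʳ : ∀ {xs ys : List A} → Unique (xs ++ ys) → Unique ys
  ++-unique⁻ʳ {[]}     ys!       = ys!
  ++-unique⁻ʳ {x ∷ xs} (_ ∷ xs!) = ++-unique⁻ʳ {xs} xs!

  ++-unique-disjoint : ∀ {xs ys : List A} {u} → Unique (xs ++ ys) → u ∈ xs → u ∈ ys → ⊥
  ++-unique-disjoint {x ∷ xs} (x∉ ∷ _)  (here refl)  u∈ys = All.lookup x∉ (∈-++⁺ʳ xs u∈ys) refl
  ++-unique-disjoint {x ∷ xs} (_ ∷ xs!) (there u∈xs) u∈ys = ++-unique-disjoint xs! u∈xs u∈ys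

  lookup-injective : ∀ {C : Set} (f : A → C) {xs : List A} → AllPairs (λ a b → f a ≢ f b) xs →
                     ∀ {i j} → f (lookup xs i) ≡ f (lookup xs j) → i ≡ j
  lookup-injective f {_ ∷ _} _          {Fin.zero}  {Fin.zero}  _ = refl
  lookup-injective f {_ ∷ _} (fx∉ ∷ _)  {Fin.zero}  {Fin.suc j} e = ⊥-elim (All.lookup fx∉ (∈-lookup j) e)
  lookup-injective f {_ ∷ _} (fx∉ ∷ _)  {Fin.suc i} {Fin.zero}  e = ⊥-elim (All.lookup fx∉ (∈-lookup i) (sym e))
  lookup-injective f {_ ∷ _} (_ ∷ fxs!) {Fin.suc i} {Fin.suc j} e = cong Fin.suc (lookup-injective f fxs! e)

  map-lookup-allFin : ∀ {B : Set} (f : A → B) (xs : List A) →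
                      map (f ∘ lookup xs) (allFin (length xs)) ≡ map f xs
  map-lookup-allFin f xs = begin
    map (f ∘ lookup xs) (tabulate (λ i → i)) ≡⟨ map-tabulate (λ i → i) (f ∘ lookup xs) ⟩
    tabulate (f ∘ lookup xs)                  ≡⟨ sym (map-tabulate (lookup xs) f) ⟩
    map f (tabulate (lookup xs))              ≡⟨ cong (map f) (tabulate-lookup xs) ⟩
    map f xs                                  ∎
    where open ≡-Reasoning

module _ {A B : Set} (f : A → List B) where

  concatMap-unique⁻ : ∀ {xs x} → Unique (concatMap f xs) → x ∈ xs → Unique (f x)
  concatMap-unique⁻ {_ ∷ _}  xs! (here refl) = ++-unique⁻ˡ xs!
  concatMap-unique⁻ {x ∷ _}  xs! (there x∈)  = concatMap-unique⁻ (++-unique⁻ʳ {xs = f x} xs!) x∈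

  concatMap-unique-disjoint : ∀ {xs x y u} → Unique (concatMap f xs) → x ∈ xs → y ∈ xs →
                              u ∈ f x → u ∈ f y → x ≡ y
  concatMap-unique-disjoint {_ ∷ xs} _   (here refl) (here refl) _ _ = refl
  concatMap-unique-disjoint {_ ∷ xs} xs! (here refl) (there y∈)  u∈fx u∈fy =
    ⊥-elim (++-unique-disjoint xs! u∈fx (∈-concatMap⁺ f (lose y∈ u∈fy)))
  concatMap-unique-disjoint {_ ∷ xs} xs! (there x∈)  (here refl) u∈fx u∈fy =
    ⊥-elim (++-unique-disjoint xs! u∈fy (∈-concatMap⁺ f (lose x∈ u∈fx)))
  concatMap-unique-disjoint {z ∷ xs} xs! (there x∈)  (there y∈)  u∈fx u∈fy =
    concatMap-unique-disjoint (++-unique⁻ʳ {xs = f z} xs!) x∈ y∈ u∈fx u∈fy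

-- Minima and order-preserving reduction of labels

minL-∈ : ∀ xs {x} → x ∈ xs → minL xs ∈ xs
minL-∈ (x ∷ [])     _ = here refl
minL-∈ (x ∷ y ∷ xs) _ with ⊓-sel x (minL (y ∷ xs)) | minL-∈ (y ∷ xs) (here refl)
... | inj₁ x⊓m≡x | _   = here x⊓m≡x
... | inj₂ x⊓m≡m | m∈ = there (subst (_∈ y ∷ xs) (sym x⊓m≡m) m∈)

length-filter-<-mono : ∀ S {x y} → x ≤ y → length (filter (_<? x) S) ≤ length (filter (_<? y) S)
length-filter-<-mono []      _   = z≤n
length-filter-<-mono (s ∷ S) {x} {y} x≤y
  with s <ᵇ x | <ᵇ-reflects-< s x | s <ᵇ y | <ᵇ-reflects-< s y
... | true  | ofʸ _   | true  | ofʸ _   = s≤s (length-filter-<-mono S x≤y)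
... | true  | ofʸ s<x | false | ofⁿ s≮y = contradiction (<-≤-trans s<x x≤y) s≮y
... | false | ofⁿ _   | true  | ofʸ _   = m≤n⇒m≤1+n (length-filter-<-mono S x≤y)
... | false | ofⁿ _   | false | ofⁿ _   = length-filter-<-mono S x≤y

length-filter-<-strictMono : ∀ S {x y} → x ∈ S → x < y → length (filter (_<? x) S) < length (filter (_<? y) S)
length-filter-<-strictMono (s ∷ S) {x} {y} x∈s∷S x<y
  with s <ᵇ x | <ᵇ-reflects-< s x | s <ᵇ y | <ᵇ-reflects-< s y | x∈s∷S
... | true  | ofʸ _   | true  | ofʸ _   | there x∈S = s≤s (length-filter-<-strictMono S x∈S x<y)
... | true  | ofʸ s<x | true  | ofʸ _   | here refl = contradiction s<x (<-irrefl refl)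
... | _     | _       | false | ofⁿ s≮y | here refl = contradiction x<y s≮y
... | true  | ofʸ s<x | false | ofⁿ s≮y | there _   = contradiction (<-trans s<x x<y) s≮y
... | false | ofⁿ _   | true  | ofʸ _   | here refl = s≤s (length-filter-<-mono S (<⇒≤ x<y))
... | false | ofⁿ _   | true  | ofʸ _   | there x∈S = m≤n⇒m≤1+n (length-filter-<-strictMono S x∈S x<y)
... | false | ofⁿ _   | false | ofⁿ _   | there x∈S = length-filter-<-strictMono S x∈S x<y

reduce-injective : ∀ S {x y} → x ∈ S → y ∈ S → reduce S x ≡ reduce S y → x ≡ y
reduce-injective S {x} {y} x∈S y∈S eq with <-cmp x y
... | tri< x<y _ _ = contradiction (suc-injective eq) (λ e → <-irrefl e (length-filter-<-strictMono S x∈S x<y))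
... | tri≈ _ x≡y _ = x≡y
... | tri> _ _ y<x = contradiction (sym (suc-injective eq)) (λ e → <-irrefl e (length-filter-<-strictMono S y∈S y<x))

-- Labeled graphs

≅-refl : ∀ {G} → G ≅ G
≅-refl = (λ _ → ⇔.refl) , (λ _ _ → ⇔.refl)

≅-reflexive : ∀ {G G'} → G ≡ G' → G ≅ G'
≅-reflexive refl = ≅-refl

≅-trans : ∀ {G G' G''} → G ≅ G' → G' ≅ G'' → G ≅ G''
≅-trans (V≅ , E≅) (V≅' , E≅') = (λ u → ⇔.trans (V≅ u) (V≅' u)) , (λ u v → ⇔.trans (E≅ u v) (E≅' u v))

IsEmpty : LGraph → Set
IsEmpty G = (∀ {u} → ¬ V G u) × (∀ {u v} → ¬ E G u v)

EdgesOnVertices : LGraph → Set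
EdgesOnVertices G = ∀ {u v} → E G u v → V G u × V G v

module _ {H : ℕ → ℕ → Bool} {k : ℕ} {pos : Fin k → ℕ} where

  induced-substG : ∀ {Gs : Fin k → LGraph} {I} → (∀ i → EdgesOnVertices (Gs i)) →
                   induced (substG H k pos Gs) I ≅ substG H k pos (λ i → induced (Gs i) I)
  induced-substG closed =
    (λ w → mk⇔ (λ { (ℓ , (i , ℓ∈) , Iℓ) → i , ℓ , ℓ∈ , Iℓ })
               (λ { (i , ℓ , ℓ∈ , Iℓ) → ℓ , (i , ℓ∈) , Iℓ })) ,
    (λ w w' → mk⇔
      (λ { (ℓ , ℓ' , _ , _ , Iℓ , Iℓ' , inj₁ (i , ℓℓ')) →
             inj₁ (i , ℓ , ℓ' , proj₁ (closed i ℓℓ') , proj₂ (closed i ℓℓ') , Iℓ , Iℓ' , ℓℓ')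
         ; (ℓ , ℓ' , _ , _ , Iℓ , Iℓ' , inj₂ (i , j , i≢j , ℓ∈ , ℓ'∈ , adj)) →
             inj₂ (i , j , i≢j , (ℓ , ℓ∈ , Iℓ) , (ℓ' , ℓ'∈ , Iℓ') , adj) })
      (λ { (inj₁ (i , ℓ , ℓ' , ℓ∈ , ℓ'∈ , Iℓ , Iℓ' , ℓℓ')) →
             ℓ , ℓ' , (i , ℓ∈) , (i , ℓ'∈) , Iℓ , Iℓ' , inj₁ (i , ℓℓ')
         ; (inj₂ (i , j , i≢j , (ℓ , ℓ∈ , Iℓ) , (ℓ' , ℓ'∈ , Iℓ') , adj)) →
             ℓ , ℓ' , (i , ℓ∈) , (j , ℓ'∈) , Iℓ , Iℓ' , inj₂ (i , j , i≢j , ℓ∈ , ℓ'∈ , adj) }))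

  substG-cong : ∀ {Gs Gs' : Fin k → LGraph} → (∀ i → Gs i ≅ Gs' i) → substG H k pos Gs ≅ substG H k pos Gs'
  substG-cong {Gs} {Gs'} Gs≅ =
    (λ u → mk⇔ (λ { (i , u∈) → i , toV i u∈ }) (λ { (i , u∈) → i , fromV i u∈ })) ,
    (λ u v → mk⇔
      (λ { (inj₁ (i , uv)) → inj₁ (i , to (proj₂ (Gs≅ i) u v) uv)
         ; (inj₂ (i , j , i≢j , u∈ , v∈ , adj)) → inj₂ (i , j , i≢j , toV i u∈ , toV j v∈ , adj) })
      (λ { (inj₁ (i , uv)) → inj₁ (i , from (proj₂ (Gs≅ i) u v) uv)
         ; (inj₂ (i , j , i≢j , u∈ , v∈ , adj)) → inj₂ (i , j , i≢j , fromV i u∈ , fromV j v∈ , adj) }))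
    where
    toV : ∀ i {u} → V (Gs i) u → V (Gs' i) u
    toV i = to (proj₁ (Gs≅ i) _)
    fromV : ∀ i {u} → V (Gs' i) u → V (Gs i) u
    fromV i = from (proj₁ (Gs≅ i) _)

  substG-reindex : ∀ {Gs : Fin k → LGraph} {H' m pos'} (idx : Fin m → Fin k) →
    (∀ {j j'} → idx j ≡ idx j' → j ≡ j') →
    (∀ i → (Σ (Fin m) λ j → idx j ≡ i) ⊎ IsEmpty (Gs i)) →
    (∀ {j j'} → j ≢ j' → H' (pos' j) (pos' j') ≡ true ⇔ H (pos (idx j)) (pos (idx j')) ≡ true) →
    substG H k pos Gs ≅ substG H' m pos' (Gs ∘ idx)
  substG-reindex {Gs} {H'} {m} {pos'} idx idx-inj covers adj =
    (λ u → mk⇔ (λ { (i , u∈) → vertex u∈ }) (λ { (j , u∈) → idx j , u∈ })) ,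
    (λ u v → mk⇔
      (λ { (inj₁ (i , uv)) → inj₁ (edge uv)
         ; (inj₂ (i , i' , i≢i' , u∈ , v∈ , h)) → inj₂ (crossEdge i≢i' u∈ v∈ h) })
      (λ { (inj₁ (j , uv)) → inj₁ (idx j , uv)
         ; (inj₂ (j , j' , j≢j' , u∈ , v∈ , h)) →
             inj₂ (idx j , idx j' , (λ e → j≢j' (idx-inj e)) , u∈ , v∈ , to (adj j≢j') h) }))
    where
    locate : ∀ i (P : LGraph → Set) → (∀ {G} → IsEmpty G → P G → ⊥) → P (Gs i) →
             Σ (Fin m) λ j → idx j ≡ i × P (Gs (idx j))
    locate i P P-nonempty p with covers i
    ... | inj₁ (j , refl) = j , refl , p
    ... | inj₂ empty      = ⊥-elim (P-nonempty empty p)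

    vertex : ∀ {i u} → V (Gs i) u → Σ (Fin m) λ j → V (Gs (idx j)) u
    vertex {i} u∈ = Product.map₂ proj₂ (locate i (λ G → V G _) (λ e → proj₁ e) u∈)

    edge : ∀ {i u v} → E (Gs i) u v → Σ (Fin m) λ j → E (Gs (idx j)) u v
    edge {i} uv = Product.map₂ proj₂ (locate i (λ G → E G _ _) (λ e → proj₂ e) uv)

    crossEdge : ∀ {i i' u v} → i ≢ i' → V (Gs i) u → V (Gs i') v → H (pos i) (pos i') ≡ true →
                Σ (Fin m) λ j → Σ (Fin m) λ j' →
                  j ≢ j' × V (Gs (idx j)) u × V (Gs (idx j')) v × H' (pos' j) (pos' j') ≡ true
    crossEdge {i} {i'} i≢i' u∈ v∈ h
      with locate i (λ G → V G _) (λ e → proj₁ e) u∈ | locate i' (λ G → V G _) (λ e → proj₁ e) v∈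
    ... | j , refl , u∈' | j' , refl , v∈' = j , j' , j≢j' , u∈' , v∈' , from (adj j≢j') h
      where
      j≢j' : j ≢ j'
      j≢j' e = i≢i' (cong idx e)

Graph-node₀ : ∀ d ts → Graph (node 0 d ts) ≅ emptyG
Graph-node₀ _ _ = (λ _ → mk⇔ (λ ()) (λ ())) , (λ _ _ → mk⇔ (λ { (inj₁ ()) ; (inj₂ ()) }) (λ ()))

Graph-node₁ : ∀ d ts → Graph (node 1 d ts) ≅ Graph (ts Fin.zero)
Graph-node₁ _ _ =
  (λ _ → mk⇔ (λ { (Fin.zero , u∈) → u∈ ; (Fin.suc () , _) }) (λ u∈ → Fin.zero , u∈)) ,
  (λ _ _ → mk⇔ (λ { (inj₁ (Fin.zero , uv)) → uv
                  ; (inj₁ (Fin.suc () , _))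
                  ; (inj₂ (Fin.zero , Fin.zero , 0≢0 , _)) → contradiction refl 0≢0
                  ; (inj₂ (Fin.zero , Fin.suc () , _))
                  ; (inj₂ (Fin.suc () , _)) })
               (λ uv → inj₁ (Fin.zero , uv)))

-- Leaves

LeavesDisjoint : ∀ {k} → (Fin k → Tree) → Set
LeavesDisjoint ts = ∀ {i i' u} → u ∈ leaves (ts i) → u ∈ leaves (ts i') → i ≡ i'

module _ {k : ℕ} (d : Deco) (ts : Fin k → Tree) where

  ∈-leaves-child : ∀ {i u} → u ∈ leaves (ts i) → u ∈ leaves (node k d ts)
  ∈-leaves-child {i} u∈ = ∈-concatMap⁺ (leaves ∘ ts) {xs = allFin k} (lose (∈-allFin i) u∈)

  ∈-leaves-node⁻ : ∀ {u} → u ∈ leaves (node k d ts) → Σ (Fin k) λ i → u ∈ leaves (ts i)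
  ∈-leaves-node⁻ u∈ with find (∈-concatMap⁻ (leaves ∘ ts) {xs = allFin k} u∈)
  ... | i , _ , u∈' = i , u∈'

  child-unique : Unique (leaves (node k d ts)) → ∀ i → Unique (leaves (ts i))
  child-unique un i = concatMap-unique⁻ (leaves ∘ ts) {xs = allFin k} un (∈-allFin i)

  children-disjoint : Unique (leaves (node k d ts)) → LeavesDisjoint ts
  children-disjoint un = concatMap-unique-disjoint (leaves ∘ ts) {xs = allFin k} un (∈-allFin _) (∈-allFin _)

PartialInjOn-antimono : ∀ {L L' I} → (∀ {u} → u ∈ L' → u ∈ L) → PartialInjOn L I → PartialInjOn L' I
PartialInjOn-antimono L'⊆L inj ℓ ℓ' w ℓ∈ ℓ'∈ = inj ℓ ℓ' w (L'⊆L ℓ∈) (L'⊆L ℓ'∈)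

Graph-vertex⇒leaf : ∀ t {u} → V (Graph t) u → u ∈ leaves t
Graph-vertex⇒leaf (leaf ℓ)      refl     = here refl
Graph-vertex⇒leaf (node k d ts) (i , u∈) = ∈-leaves-child d ts (Graph-vertex⇒leaf (ts i) u∈)

leaf⇒Graph-vertex : ∀ t {u} → u ∈ leaves t → V (Graph t) u
leaf⇒Graph-vertex (leaf ℓ)      (here refl) = refl
leaf⇒Graph-vertex (node k d ts) u∈ with ∈-leaves-node⁻ d ts u∈
... | i , u∈' = i , leaf⇒Graph-vertex (ts i) u∈'

Graph-edgesOnVertices : ∀ t → EdgesOnVertices (Graph t)
Graph-edgesOnVertices (leaf ℓ) ()
Graph-edgesOnVertices (node k d ts) (inj₁ (i , uv)) =
  (i , proj₁ (Graph-edgesOnVertices (ts i) uv)) , (i , proj₂ (Graph-edgesOnVertices (ts i) uv))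
Graph-edgesOnVertices (node k d ts) (inj₂ (i , j , _ , u∈ , v∈ , _)) = (i , u∈) , (j , v∈)

WF-nonempty : ∀ t → WF t → Σ ℕ (_∈ leaves t)
WF-nonempty (leaf ℓ)             _            = ℓ , here refl
WF-nonempty (node (suc k) d ts) (_ , _ , wf) with WF-nonempty (ts Fin.zero) (wf Fin.zero)
... | u , u∈ = u , ∈-leaves-child d ts u∈

rank-injective : ∀ {k} (ts : Fin k → Tree) → (∀ i → WF (ts i)) → LeavesDisjoint ts →
                 ∀ {i i'} → rank k ts i ≡ rank k ts i' → i ≡ i'
rank-injective ts wf disjoint {i} {i'} eq =
  disjoint (minLabel∈ i) (subst (_∈ leaves (ts i')) (sym minLabel≡) (minLabel∈ i'))
  where
  minLabel∈ : ∀ i → minLabel (ts i) ∈ leaves (ts i)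
  minLabel∈ i = minL-∈ (leaves (ts i)) (proj₂ (WF-nonempty (ts i) (wf i)))
  minLabel≡ : minLabel (ts i) ≡ minLabel (ts i')
  minLabel≡ = reduce-injective _ (∈-map⁺ (minLabel ∘ ts) (∈-allFin i)) (∈-map⁺ (minLabel ∘ ts) (∈-allFin i')) eq

-- The marked children

record Tabulates {A : Set} {k : ℕ} (rs : Fin k → Maybe A) (L : List (Fin k × A)) : Set where
  field
    complete : ∀ {i s} → rs i ≡ just s → (i , s) ∈ L
    sound    : ∀ {p} → p ∈ L → rs (proj₁ p) ≡ just (proj₂ p)
    distinct : AllPairs (λ p q → proj₁ p ≢ proj₁ q) L

module _ {A B : Set} (h : A → Maybe B) where

  definedPairs : List A → List (A × B)
  definedPairs = mapMaybe (λ a → Maybe.map (a ,_) (h a))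

  ∈-definedPairs⁺ : ∀ {xs a b} → a ∈ xs → h a ≡ just b → (a , b) ∈ definedPairs xs
  ∈-definedPairs⁺ {x ∷ _}  (here refl) ha with h x
  ∈-definedPairs⁺ {x ∷ _}  (here refl) () | nothing
  ∈-definedPairs⁺ {x ∷ _}  (here refl) refl | just _ = here refl
  ∈-definedPairs⁺ {x ∷ xs} (there a∈) ha with h x
  ... | nothing = ∈-definedPairs⁺ a∈ ha
  ... | just _  = there (∈-definedPairs⁺ a∈ ha)

  ∈-definedPairs⁻ : ∀ {xs p} → p ∈ definedPairs xs → proj₁ p ∈ xs × h (proj₁ p) ≡ just (proj₂ p)
  ∈-definedPairs⁻ {x ∷ xs} p∈ with h x in hx
  ∈-definedPairs⁻ {x ∷ xs} p∈          | nothing = Product.map₁ there (∈-definedPairs⁻ p∈)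
  ∈-definedPairs⁻ {x ∷ xs} (here refl) | just _  = here refl , hx
  ∈-definedPairs⁻ {x ∷ xs} (there p∈)  | just _  = Product.map₁ there (∈-definedPairs⁻ p∈)

  definedPairs-distinct : ∀ {xs} → Unique xs → AllPairs (λ p q → proj₁ p ≢ proj₁ q) (definedPairs xs)
  definedPairs-distinct {[]}     _          = []
  definedPairs-distinct {x ∷ xs} (x∉ ∷ xs!) with h x
  ... | nothing = definedPairs-distinct xs!
  ... | just _  = All.tabulate x≢ ∷ definedPairs-distinct xs!
    where
    x≢ : ∀ {q} → q ∈ definedPairs xs → x ≢ proj₁ q
    x≢ q∈ x≡ = All.lookup x∉ (subst (_∈ xs) (sym x≡) (proj₁ (∈-definedPairs⁻ q∈))) refl

marked-tabulates : ∀ {k} (rs : Fin k → Maybe Tree) → Tabulates rs (marked k rs)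
marked-tabulates {k} rs = record
  { complete = ∈-definedPairs⁺ rs (∈-allFin _)
  ; sound    = λ p∈ → proj₂ (∈-definedPairs⁻ rs {xs = allFin k} p∈)
  ; distinct = definedPairs-distinct rs (allFin⁺ k)
  }

module _ {A : Set} {k : ℕ} {rs : Fin k → Maybe A} {L : List (Fin k × A)} (tab : Tabulates rs L) where

  open Tabulates tab

  tabulates-functional : ∀ {p q} → p ∈ L → q ∈ L → proj₁ p ≡ proj₁ q → p ≡ q
  tabulates-functional {i , _} p∈ q∈ refl = cong (i ,_) (just-injective (trans (sym (sound p∈)) (sound q∈)))

  position : Fin (length L) → Fin k
  position j = proj₁ (lookup L j)

  position-injective : ∀ {j j'} → position j ≡ position j' → j ≡ j'
  position-injective = lookup-injective proj₁ distinct

  position-covers : ∀ {i s} → rs i ≡ just s → Σ (Fin (length L)) λ j → position j ≡ i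
  position-covers rsi = index (complete rsi) , cong proj₁ (sym (lookup-index (complete rsi)))

-- Relabelling the decoration

⊕-adjacent : ∀ {a b} → a ≢ b → decoAdj ⊕ a b ≡ true
⊕-adjacent {a} {b} a≢b with a ≡ᵇ b in a≡ᵇb
... | false = refl
... | true  = contradiction (≡ᵇ⇒≡ a b (subst T (sym a≡ᵇb) _)) a≢b

any-relabel : ∀ {A : Set} (f : A → ℕ) (R : A → A → Bool) {L : List A} →
  (∀ {a b} → a ∈ L → b ∈ L → f a ≡ f b → a ≡ b) → ∀ {a b} → a ∈ L → b ∈ L →
  any (λ a' → any (λ b' → (f a' ≡ᵇ f a) ∧ (f b' ≡ᵇ f b) ∧ R a' b') L) L ≡ true ⇔ R a b ≡ true
any-relabel f R {L} f-inj {a} {b} a∈ b∈ = ⇔.trans (⇔.sym T-≡) (⇔.trans (mk⇔ select witness) T-≡)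
  where
  select : T (any (λ a' → any (λ b' → (f a' ≡ᵇ f a) ∧ (f b' ≡ᵇ f b) ∧ R a' b') L) L) → T (R a b)
  select t =
    let a' , a'∈ , t₁ = find (any⁻ _ L t)
        b' , b'∈ , t₂ = find (any⁻ _ L t₁)
        fa'≡fa , t₃   = to T-∧ t₂
        fb'≡fb , r    = to T-∧ t₃
    in subst₂ (λ x y → T (R x y)) (f-inj a'∈ a∈ (≡ᵇ⇒≡ _ _ fa'≡fa)) (f-inj b'∈ b∈ (≡ᵇ⇒≡ _ _ fb'≡fb)) r
  witness : T (R a b) → T (any (λ a' → any (λ b' → (f a' ≡ᵇ f a) ∧ (f b' ≡ᵇ f b) ∧ R a' b') L) L)
  witness r = any⁺ _ (lose a∈ (any⁺ _ (lose b∈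
    (from T-∧ (≡⇒≡ᵇ (f a) (f a) refl , from T-∧ (≡⇒≡ᵇ (f b) (f b) refl , r))))))

module _ {k : ℕ} (ts : Fin k → Tree) (L : List (Fin k × Tree)) where

  newLabel : Fin k × Tree → ℕ
  newLabel p = reduce (map (minLabel ∘ proj₂) L) (minLabel (proj₂ p))

  rank-lookup : ∀ j → rank (length L) (proj₂ ∘ lookup L) j ≡ newLabel (lookup L j)
  rank-lookup j = cong (λ S → reduce S (minLabel (proj₂ (lookup L j)))) (map-lookup-allFin (minLabel ∘ proj₂) L)

  newDeco-adjacency : ∀ d → (∀ {p q} → p ∈ L → q ∈ L → newLabel p ≡ newLabel q → p ≡ q) →
    (∀ {i i'} → rank k ts i ≡ rank k ts i' → i ≡ i') →
    ∀ {p q} → p ∈ L → q ∈ L → proj₁ p ≢ proj₁ q →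
    decoAdj (newDeco k ts L d) (newLabel p) (newLabel q) ≡ true ⇔
    decoAdj d (rank k ts (proj₁ p)) (rank k ts (proj₁ q)) ≡ true
  newDeco-adjacency ⊕ newLabel-inj rank-inj p∈ q∈ p≢q =
    mk⇔ (λ _ → ⊕-adjacent (p≢q ∘ rank-inj))
        (λ _ → ⊕-adjacent (λ e → p≢q (cong proj₁ (newLabel-inj p∈ q∈ e))))
  newDeco-adjacency ⊖ _ _ _ _ _ = ⇔.refl
  newDeco-adjacency (gr H) newLabel-inj _ p∈ q∈ _ =
    any-relabel newLabel (λ p q → H (rank k ts (proj₁ p)) (rank k ts (proj₁ q))) newLabel-inj p∈ q∈

substG-select : ∀ {k} d (ts : Fin k → Tree) {rs : Fin k → Maybe Tree} {L} → Tabulates rs L →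
  (∀ {i i'} → rank k ts i ≡ rank k ts i' → i ≡ i') →
  (∀ {i i' s s'} → rs i ≡ just s → rs i' ≡ just s' → minLabel s ≡ minLabel s' → i ≡ i') →
  substG (decoAdj d) k (rank k ts) (GraphM ∘ rs) ≅ Graph (node (length L) (newDeco k ts L d) (proj₂ ∘ lookup L))
substG-select {k} d ts {rs} {L} tab rank-inj minLabel-inj =
  ≅-trans (substG-reindex {decoAdj d} {k} {rank k ts} {GraphM ∘ rs} {decoAdj newDeco'} {length L} {newRank}
                          (position tab) (position-injective tab) covers adjacency)
          (substG-cong {decoAdj newDeco'} {length L} {newRank}
                       (λ j → ≅-reflexive (cong GraphM (sound (∈-lookup j)))))
  where
  open Tabulates tab

  newDeco' : Deco
  newDeco' = newDeco k ts L d

  newRank : Fin (length L) → ℕ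
  newRank = rank (length L) (proj₂ ∘ lookup L)

  covers : ∀ i → (Σ (Fin (length L)) λ j → position tab j ≡ i) ⊎ IsEmpty (GraphM (rs i))
  covers i with rs i in rsi
  ... | nothing = inj₂ ((λ ()) , (λ ()))
  ... | just _  = inj₁ (position-covers tab rsi)

  newLabel-injective : ∀ {p q} → p ∈ L → q ∈ L → newLabel ts L p ≡ newLabel ts L q → p ≡ q
  newLabel-injective p∈ q∈ eq = tabulates-functional tab p∈ q∈ (minLabel-inj (sound p∈) (sound q∈)
    (reduce-injective _ (∈-map⁺ (minLabel ∘ proj₂) p∈) (∈-map⁺ (minLabel ∘ proj₂) q∈) eq))

  adjacency : ∀ {j j'} → j ≢ j' →
    decoAdj newDeco' (newRank j) (newRank j') ≡ true ⇔
    decoAdj d (rank k ts (position tab j)) (rank k ts (position tab j')) ≡ true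
  adjacency {j} {j'} j≢j' rewrite rank-lookup ts L j | rank-lookup ts L j' =
    newDeco-adjacency ts L d newLabel-injective rank-inj (∈-lookup j) (∈-lookup j') (j≢j' ∘ position-injective tab)

build-correct : ∀ {k} d (ts : Fin k → Tree) (rs : Fin k → Maybe Tree) →
  (∀ {i i'} → rank k ts i ≡ rank k ts i' → i ≡ i') →
  (∀ {i i' s s'} → rs i ≡ just s → rs i' ≡ just s' → minLabel s ≡ minLabel s' → i ≡ i') →
  substG (decoAdj d) k (rank k ts) (GraphM ∘ rs) ≅ GraphM (build k d ts rs)
build-correct {k} d ts rs rank-inj minLabel-inj with marked k rs | marked-tabulates rs
... | L@[]          | tab = ≅-trans (substG-select d ts tab rank-inj minLabel-inj)
                                  (Graph-node₀ (newDeco k ts L d) (proj₂ ∘ lookup L))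
... | L@(_ ∷ [])    | tab = ≅-trans (substG-select d ts tab rank-inj minLabel-inj)
                                  (Graph-node₁ (newDeco k ts L d) (proj₂ ∘ lookup L))
... | _ ∷ _ ∷ _     | tab = substG-select d ts tab rank-inj minLabel-inj

-- Induced subtrees

-- Needed because minL [] is the junk value 0.
induceTree-nonempty : ∀ I t {s} → induceTree I t ≡ just s → Σ ℕ (_∈ leaves s)
induceTree-nonempty I (leaf ℓ) eq with I ℓ
induceTree-nonempty I (leaf ℓ) ()   | nothing
induceTree-nonempty I (leaf ℓ) refl | just w = w , here refl
induceTree-nonempty I (node k d ts) eq
  with marked k (λ i → induceTree I (ts i)) | marked-tabulates (λ i → induceTree I (ts i))
induceTree-nonempty I (node k d ts) () | [] | _
induceTree-nonempty I (node k d ts) refl | p ∷ [] | tab =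
  induceTree-nonempty I (ts (proj₁ p)) (Tabulates.sound tab (here refl))
induceTree-nonempty I (node k d ts) refl | L@(p ∷ _ ∷ _) | tab
  with induceTree-nonempty I (ts (proj₁ p)) (Tabulates.sound tab (here refl))
... | u , u∈ = u , ∈-leaves-child (newDeco k ts L d) (proj₂ ∘ lookup L) {Fin.zero} u∈

induced-leaf : ∀ ℓ I → induced (Graph (leaf ℓ)) I ≅ GraphM (induceTree I (leaf ℓ))
induced-leaf ℓ I =
  (λ w → mk⇔ (λ { (_ , refl , Iℓ) → subst (λ m → V (GraphM (Maybe.map leaf m)) w) (sym Iℓ) refl })
             (λ w∈ → ℓ , refl , marked-label (I ℓ) w∈)) ,
  (λ _ _ → mk⇔ (λ { (_ , _ , _ , _ , _ , _ , ()) }) (λ uv → ⊥-elim (no-edge (I ℓ) uv)))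
  where
  marked-label : ∀ m {w} → V (GraphM (Maybe.map leaf m)) w → m ≡ just w
  marked-label (just _) refl = refl
  no-edge : ∀ m {u v} → ¬ E (GraphM (Maybe.map leaf m)) u v
  no-edge nothing  ()
  no-edge (just _) ()

marked-minLabel-injective : ∀ {k} (ts : Fin k → Tree) {I} → LeavesDisjoint ts →
  (∀ {i i' ℓ ℓ' w} → ℓ ∈ leaves (ts i) → ℓ' ∈ leaves (ts i') → I ℓ ≡ just w → I ℓ' ≡ just w → ℓ ≡ ℓ') →
  (∀ i → induced (Graph (ts i)) I ≅ GraphM (induceTree I (ts i))) →
  ∀ {i i' s s'} → induceTree I (ts i) ≡ just s → induceTree I (ts i') ≡ just s' → minLabel s ≡ minLabel s' → i ≡ i'
marked-minLabel-injective ts {I} disjoint I-inj IH {i' = i'} rsi rsi' eq =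
  let ℓ  , ℓ∈  , Iℓ  = origin rsi
      ℓ' , ℓ'∈ , Iℓ' = origin rsi'
  in disjoint ℓ∈ (subst (_∈ leaves (ts i')) (sym (I-inj ℓ∈ ℓ'∈ (trans Iℓ (cong just eq)) Iℓ')) ℓ'∈)
  where
  origin : ∀ {i s} → induceTree I (ts i) ≡ just s → Σ ℕ λ ℓ → ℓ ∈ leaves (ts i) × I ℓ ≡ just (minLabel s)
  origin {i} {s} rsi with from (proj₁ (IH i) (minLabel s))
      (subst (λ m → V (GraphM m) (minLabel s)) (sym rsi)
        (leaf⇒Graph-vertex s (minL-∈ (leaves s) (proj₂ (induceTree-nonempty I (ts i) rsi)))))
  ... | ℓ , ℓ∈ , Iℓ = ℓ , Graph-vertex⇒leaf (ts i) ℓ∈ , Iℓ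

lemma5p4 : (t : Tree) → WF t → Unique (leaves t) →
    (I : ℕ → Maybe ℕ) → PartialInjOn (leaves t) I →
    induced (Graph t) I ≅ GraphM (induceTree I t)
lemma5p4 (leaf ℓ)      _            _  I _     = induced-leaf ℓ I
lemma5p4 (node k d ts) (_ , _ , wf) un I I-inj =
  ≅-trans (induced-substG {decoAdj d} {k} {rank k ts} {Graph ∘ ts} (Graph-edgesOnVertices ∘ ts))
  (≅-trans (substG-cong {decoAdj d} {k} {rank k ts} IH)
           (build-correct d ts rs (rank-injective ts wf disjoint)
             (marked-minLabel-injective ts disjoint
               (λ ℓ∈ ℓ'∈ → I-inj _ _ _ (∈-leaves-child d ts ℓ∈) (∈-leaves-child d ts ℓ'∈)) IH)))
  where
  rs : Fin k → Maybe Tree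
  rs i = induceTree I (ts i)

  disjoint : LeavesDisjoint ts
  disjoint = children-disjoint d ts un

  IH : ∀ i → induced (Graph (ts i)) I ≅ GraphM (rs i)
  IH i = lemma5p4 (ts i) (wf i) (child-unique d ts un i) I (PartialInjOn-antimono (∈-leaves-child d ts) I-inj)
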